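{- For an integer $m\ge0$ and real $v,x$ let $P_m(v,x)=(v+1-x)(v+2-x)\cdots(v+m-x)$ (with $P_0\equiv 1$) and, for an integer $k$, \[ \tilde\Delta_{m,k}(v,x)=\sum_{r=0}^k\binom{k}{r}(-1)^r P_m(v,(r+1)x). \] If $m$ is a non-negative integer, $k$ is an integer, $v\ge0$ and $0\le x\le1$, then $\tilde\Delta_{m,k}(v,x)\ge0$.
   Context: For $k<0$ the sum defining $\tilde\Delta_{m,k}$ is empty and equals $0$. -}

module Defs where

open import Level using (Level; _⊔_)
open import Data.Nat using (ℕ; zero; suc)
open import Data.Nat.Combinatorics using (_C_)
open import Data.Integer using (ℤ; +_; -[1+_])
open import Algebra.Bundles using (CommutativeRing)
open import Relation.Binary.Structures using (IsTotalOrder)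

-- An ordered commutative ring (standard axioms).  The real numbers ℝ are an
-- instance; the stdlib has no reals, so the statement is made for every
-- ordered commutative ring (which includes ℝ).
record OrderedCommRing (c ℓ₁ ℓ₂ : Level) : Set (Level.suc (c ⊔ ℓ₁ ⊔ ℓ₂)) where
  field
    commutativeRing : CommutativeRing c ℓ₁
  open CommutativeRing commutativeRing public
  field
    _≤_          : Carrier → Carrier → Set ℓ₂
    isTotalOrder : IsTotalOrder _≈_ _≤_
    +-monoˡ-≤    : ∀ {x y} z → x ≤ y → (x + z) ≤ (y + z)
    *-nonneg     : ∀ {x y} → 0# ≤ x → 0# ≤ y → 0# ≤ (x * y)

module _ {c ℓ₁ ℓ₂} (R : OrderedCommRing c ℓ₁ ℓ₂) where
  open OrderedCommRing R using (Carrier; 0#; 1#; _+_; _*_; -_; _-_)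

  ι : ℕ → Carrier
  ι zero    = 0#
  ι (suc n) = 1# + ι n

  pow : Carrier → ℕ → Carrier
  pow x zero    = 1#
  pow x (suc n) = pow x n * x

  P : ℕ → Carrier → Carrier → Carrier
  P zero    v x = 1#
  P (suc m) v x = P m v x * (v + ι (suc m) - x)

  sumUpTo : ℕ → (ℕ → Carrier) → Carrier
  sumUpTo zero    f = f zero
  sumUpTo (suc n) f = sumUpTo n f + f (suc n)

  Δ̃ℕ : ℕ → ℕ → Carrier → Carrier → Carrier
  Δ̃ℕ m k v x = sumUpTo k (λ r → (ι (k C r) * pow (- 1#) r) * P m v (ι (suc r) * x))

  -- Δ̃_{m,k}(v,x) for k : ℤ (empty sum = 0 for k < 0)
  Δ̃ : ℕ → ℤ → Carrier → Carrier → Carrier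
  Δ̃ m (+ k)      v x = Δ̃ℕ m k v x
  Δ̃ m -[1+ _ ]   v x = 0#

{-# OPTIONS --safe #-}
-- Δ̃_{m,k}(v,x) is ((1 − S)^k g)(0) for g(r) = P_m(v,(r+1)x) and the shift S.  Peeling the
-- first factor, P_{m+1}(v,y) = (v+1−y) P_m(v+1,y), writes g(r) = (v+1−x) h(r) − x r h(r) with
-- h(r) = P_m(v+1,(r+1)x).  By the discrete Leibniz rule ((1−S)^{j+1}(r h))(0) = −(j+1)((1−S)^j S h)(0),
-- and S h(r) = P_m(v+1−x,(r+1)x) because P_m(v,y) depends only on v − y.  Hence
--   Δ̃_{m+1,j+1}(v,x) = (v+1−x) Δ̃_{m,j+1}(v+1,x) + x (j+1) Δ̃_{m,j}(v+1−x,x),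
-- and both terms are non-negative by induction on m, since v + 1 − x ≥ 0 when x ≤ 1.
module Submission where

open import Defs
open import Data.Nat as ℕ using (ℕ; zero; suc)
open import Data.Nat.Properties using (n<1+n)
open import Data.Nat.Combinatorics using (_C_; k>n⇒nCk≡0; nCk+nC[k+1]≡[n+1]C[k+1])
open import Data.Integer using (ℤ; +_; -[1+_])
open import Data.Sum using (inj₁; inj₂)
open import Relation.Binary.PropositionalEquality using (cong) renaming (sym to sym′)
open import Relation.Binary.Structures using (IsTotalOrder)
import Algebra.Properties.Ring as RingProperties
import Algebra.Properties.CommutativeSemigroup as CommutativeSemigroupProperties
import Relation.Binary.Reasoning.Setoid as SetoidReasoning

module _ {c ℓ₁ ℓ₂} (R : OrderedCommRing c ℓ₁ ℓ₂) where
  open OrderedCommRing R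
  open IsTotalOrder isTotalOrder using (total; ≤-respˡ-≈; ≤-respʳ-≈)
    renaming (trans to ≤-trans; reflexive to ≤-reflexive)
  open RingProperties ring
    using (-‿+-comm; -‿involutive; -‿distribˡ-*; -‿distribʳ-*; -1*x≈-x; x[y-z]≈xy-xz; [y-z]x≈yx-zx)
  open CommutativeSemigroupProperties +-commutativeSemigroup using (interchange; x∙yz≈y∙xz)
  open SetoidReasoning setoid

  [x+y]-[z+w]≈[x-z]+[y-w] : ∀ x y z w → (x + y) - (z + w) ≈ (x - z) + (y - w)
  [x+y]-[z+w]≈[x-z]+[y-w] x y z w = trans (+-congˡ (sym (-‿+-comm z w))) (interchange x y (- z) (- w))

  x+y-z≈x-z+y : ∀ x y z → x + y - z ≈ x - z + y
  x+y-z≈x-z+y x y z = begin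
    (x + y) - z    ≈⟨ +-assoc x y (- z) ⟩
    x + (y - z)    ≈⟨ +-congˡ (+-comm y (- z)) ⟩
    x + (- z + y)  ≈⟨ +-assoc x (- z) y ⟨
    (x - z) + y    ∎

  x-[y+z]≈x-y-z : ∀ x y z → x - (y + z) ≈ x - y - z
  x-[y+z]≈x-y-z x y z = trans (+-congˡ (sym (-‿+-comm y z))) (sym (+-assoc x (- y) (- z)))

  x*-1≈-x : ∀ x → x * - 1# ≈ - x
  x*-1≈-x x = trans (sym (-‿distribʳ-* x 1#)) (-‿cong (*-identityʳ x))

  -x*-y≈x*y : ∀ x y → - x * - y ≈ x * y
  -x*-y≈x*y x y = begin
    - x * - y      ≈⟨ -‿distribˡ-* x (- y) ⟨
    - (x * - y)    ≈⟨ -‿cong (-‿distribʳ-* x y) ⟨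
    - (- (x * y))  ≈⟨ -‿involutive (x * y) ⟩
    x * y          ∎

  [x+y]*-z≈y*-z-x*z : ∀ x y z → (x + y) * - z ≈ y * - z - x * z
  [x+y]*-z≈y*-z-x*z x y z = begin
    (x + y) * - z        ≈⟨ distribʳ (- z) x y ⟩
    x * - z + y * - z    ≈⟨ +-comm _ _ ⟩
    y * - z + x * - z    ≈⟨ +-congˡ (-‿distribʳ-* x z) ⟨
    y * - z - x * z      ∎

  x≤y⇒0≤y-x : ∀ {x y} → x ≤ y → 0# ≤ (y - x)
  x≤y⇒0≤y-x {x} x≤y = ≤-respˡ-≈ (-‿inverseʳ x) (+-monoˡ-≤ (- x) x≤y)

  +-nonneg : ∀ {x y} → 0# ≤ x → 0# ≤ y → 0# ≤ (x + y)
  +-nonneg {x} {y} 0≤x 0≤y = ≤-trans 0≤x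
    (≤-respʳ-≈ (+-comm y x) (≤-respˡ-≈ (+-identityˡ x) (+-monoˡ-≤ x 0≤y)))

  -- If 1 ≤ 0 then 0 ≤ -1, and so 0 ≤ (-1)(-1) = 1 anyway.
  0≤1 : 0# ≤ 1#
  0≤1 with total 0# 1#
  ... | inj₁ 0≤1 = 0≤1
  ... | inj₂ 1≤0 = ≤-respʳ-≈ (trans (-1*x≈-x (- 1#)) (-‿involutive 1#)) (*-nonneg 0≤-1 0≤-1)
    where
    0≤-1 : 0# ≤ (- 1#)
    0≤-1 = ≤-respʳ-≈ (+-identityˡ (- 1#)) (x≤y⇒0≤y-x 1≤0)

  ι-nonneg : ∀ n → 0# ≤ (ι R n)
  ι-nonneg zero    = ≤-reflexive refl
  ι-nonneg (suc n) = +-nonneg 0≤1 (ι-nonneg n)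

  ι-+ : ∀ m n → ι R (m ℕ.+ n) ≈ ι R m + ι R n
  ι-+ zero    n = sym (+-identityˡ (ι R n))
  ι-+ (suc m) n = trans (+-congˡ (ι-+ m n)) (sym (+-assoc 1# (ι R m) (ι R n)))

  ι-suc-* : ∀ n x → ι R (suc n) * x ≈ x + ι R n * x
  ι-suc-* n x = trans (distribʳ x 1# (ι R n)) (+-congʳ (*-identityˡ x))

  sumUpTo-cong : ∀ n {f g : ℕ → Carrier} → (∀ r → f r ≈ g r) → sumUpTo R n f ≈ sumUpTo R n g
  sumUpTo-cong zero    f≈g = f≈g 0
  sumUpTo-cong (suc n) f≈g = +-cong (sumUpTo-cong n f≈g) (f≈g (suc n))

  sumUpTo-suc : ∀ n f → sumUpTo R (suc n) f ≈ f 0 + sumUpTo R n (λ r → f (suc r))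
  sumUpTo-suc zero    f = refl
  sumUpTo-suc (suc n) f = trans (+-congʳ (sumUpTo-suc n f)) (+-assoc _ _ _)

  sumUpTo-- : ∀ n f g → sumUpTo R n (λ r → f r - g r) ≈ sumUpTo R n f - sumUpTo R n g
  sumUpTo-- zero    f g = refl
  sumUpTo-- (suc n) f g =
    trans (+-congʳ (sumUpTo-- n f g)) (sym ([x+y]-[z+w]≈[x-z]+[y-w] _ _ _ _))

  -- Δ k f = ((1 − S)^k f)(0) for the shift S f = f ∘ suc: (−1)^k times the usual k-th forward difference.
  Δ : ℕ → (ℕ → Carrier) → Carrier
  Δ zero    f = f 0
  Δ (suc k) f = Δ k f - Δ k (λ r → f (suc r))

  Δ-cong : ∀ k {f g : ℕ → Carrier} → (∀ r → f r ≈ g r) → Δ k f ≈ Δ k g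
  Δ-cong zero    f≈g = f≈g 0
  Δ-cong (suc k) f≈g = +-cong (Δ-cong k f≈g) (-‿cong (Δ-cong k (λ r → f≈g (suc r))))

  Δ-+ : ∀ k f g → Δ k (λ r → f r + g r) ≈ Δ k f + Δ k g
  Δ-+ zero    f g = refl
  Δ-+ (suc k) f g = trans (+-cong (Δ-+ k f g) (-‿cong (Δ-+ k (λ r → f (suc r)) (λ r → g (suc r)))))
    ([x+y]-[z+w]≈[x-z]+[y-w] _ _ _ _)

  Δ-*ˡ : ∀ k a f → Δ k (λ r → a * f r) ≈ a * Δ k f
  Δ-*ˡ zero    a f = refl
  Δ-*ˡ (suc k) a f = trans (+-cong (Δ-*ˡ k a f) (-‿cong (Δ-*ˡ k a (λ r → f (suc r)))))
    (sym (x[y-z]≈xy-xz a _ _))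

  Δ-const-nonneg : ∀ k {a} → 0# ≤ a → 0# ≤ Δ k (λ _ → a)
  Δ-const-nonneg zero    0≤a = 0≤a
  Δ-const-nonneg (suc k) 0≤a = ≤-reflexive (sym (-‿inverseʳ _))

  Δ-ι* : ∀ k f → Δ (suc k) (λ r → ι R r * f r) ≈ - (ι R (suc k) * Δ k (λ r → f (suc r)))
  Δ-ι* zero    f = trans (+-congʳ (zeroˡ (f 0))) (+-identityˡ _)
  Δ-ι* (suc k) f = begin
    Δ (suc k) (λ r → ι R r * f r) - Δ (suc k) (λ r → ι R (suc r) * f (suc r))
      ≈⟨ +-cong (Δ-ι* k f) (-‿cong shifted) ⟩
    - (i * A) - (D - i * B)    ≈⟨ -‿+-comm (i * A) (D - i * B) ⟩
    - (i * A + (D - i * B))    ≈⟨ -‿cong (x∙yz≈y∙xz (i * A) D (- (i * B))) ⟩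
    - (D + (i * A - i * B))    ≈⟨ -‿cong (+-congˡ (x[y-z]≈xy-xz i A B)) ⟨
    - (D + i * D)              ≈⟨ -‿cong (ι-suc-* (suc k) D) ⟨
    - (ι R (suc (suc k)) * D)  ∎
    where
    f′ : ℕ → Carrier
    f′ r = f (suc r)
    i A B D : Carrier
    i = ι R (suc k)
    A = Δ k f′
    B = Δ k (λ r → f′ (suc r))
    D = A - B
    shifted : Δ (suc k) (λ r → ι R (suc r) * f′ r) ≈ D - i * B
    shifted = begin
      Δ (suc k) (λ r → ι R (suc r) * f′ r)       ≈⟨ Δ-cong (suc k) (λ r → ι-suc-* r (f′ r)) ⟩
      Δ (suc k) (λ r → f′ r + ι R r * f′ r)      ≈⟨ Δ-+ (suc k) f′ (λ r → ι R r * f′ r) ⟩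
      D + Δ (suc k) (λ r → ι R r * f′ r)         ≈⟨ +-congˡ (Δ-ι* k f′) ⟩
      D - i * B                                  ∎

  alternatingBinomialSum : ℕ → (ℕ → Carrier) → Carrier
  alternatingBinomialSum k f = sumUpTo R k (λ r → (ι R (k C r) * pow R (- 1#) r) * f r)

  ι-pascal : ∀ k r → ι R (suc k C suc r) ≈ ι R (k C r) + ι R (k C suc r)
  ι-pascal k r = trans (reflexive (cong (ι R) (sym′ (nCk+nC[k+1]≡[n+1]C[k+1] k r)))) (ι-+ (k C r) (k C suc r))

  alternatingBinomialSum-suc : ∀ k f →
    alternatingBinomialSum (suc k) f ≈ alternatingBinomialSum k f - alternatingBinomialSum k (λ r → f (suc r))
  alternatingBinomialSum-suc k f = begin
    alternatingBinomialSum (suc k) f                ≈⟨ sumUpTo-suc k _ ⟩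
    b 0 + sumUpTo R k (λ r → b₊ (suc r))            ≈⟨ +-congˡ (sumUpTo-cong k pascal) ⟩
    b 0 + sumUpTo R k (λ r → b (suc r) - b′ r)      ≈⟨ +-congˡ (sumUpTo-- k (λ r → b (suc r)) b′) ⟩
    b 0 + (sumUpTo R k (λ r → b (suc r)) - T′)      ≈⟨ +-assoc _ _ _ ⟨
    (b 0 + sumUpTo R k (λ r → b (suc r))) - T′      ≈⟨ +-congʳ (sumUpTo-suc k b) ⟨
    (alternatingBinomialSum k f + b (suc k)) - T′   ≈⟨ +-congʳ (trans (+-congˡ b[1+k]≈0) (+-identityʳ _)) ⟩
    alternatingBinomialSum k f - T′                 ∎
    where
    b₊ b b′ : ℕ → Carrier
    b₊ r = (ι R (suc k C r) * pow R (- 1#) r) * f r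
    b  r = (ι R (k C r) * pow R (- 1#) r) * f r
    b′ r = (ι R (k C r) * pow R (- 1#) r) * f (suc r)
    T′ : Carrier
    T′ = alternatingBinomialSum k (λ r → f (suc r))
    b[1+k]≈0 : b (suc k) ≈ 0#
    b[1+k]≈0 = trans (*-congʳ (*-congʳ (reflexive (cong (ι R) (k>n⇒nCk≡0 (n<1+n k))))))
                     (trans (*-congʳ (zeroˡ _)) (zeroˡ _))
    pascal : ∀ r → b₊ (suc r) ≈ b (suc r) - b′ r
    pascal r = begin
      (ι R (suc k C suc r) * (p * - 1#)) * y               ≈⟨ *-congʳ (*-cong (ι-pascal k r) (x*-1≈-x p)) ⟩
      ((ι R (k C r) + ι R (k C suc r)) * - p) * y          ≈⟨ *-congʳ ([x+y]*-z≈y*-z-x*z _ _ p) ⟩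
      (ι R (k C suc r) * - p - ι R (k C r) * p) * y        ≈⟨ [y-z]x≈yx-zx y _ _ ⟩
      (ι R (k C suc r) * - p) * y - (ι R (k C r) * p) * y  ≈⟨ +-congʳ (*-congʳ (*-congˡ (x*-1≈-x p))) ⟨
      b (suc r) - b′ r                                     ∎
      where
      p y : Carrier
      p = pow R (- 1#) r
      y = f (suc r)

  alternatingBinomialSum≈Δ : ∀ k f → alternatingBinomialSum k f ≈ Δ k f
  alternatingBinomialSum≈Δ zero    f =
    trans (*-congʳ (trans (*-identityʳ _) (+-identityʳ 1#))) (*-identityˡ (f 0))
  alternatingBinomialSum≈Δ (suc k) f = trans (alternatingBinomialSum-suc k f)
    (+-cong (alternatingBinomialSum≈Δ k f) (-‿cong (alternatingBinomialSum≈Δ k (λ r → f (suc r)))))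

  P-suc : ∀ m v y → P R (suc m) v y ≈ (v + 1# - y) * P R m (v + 1#) y
  P-suc zero    v y = begin
    1# * (v + (1# + 0#) - y)  ≈⟨ *-identityˡ _ ⟩
    v + (1# + 0#) - y         ≈⟨ +-congʳ (+-congˡ (+-identityʳ 1#)) ⟩
    v + 1# - y                ≈⟨ *-identityʳ _ ⟨
    (v + 1# - y) * 1#         ∎
  P-suc (suc m) v y = begin
    P R (suc m) v y * (v + ι R (suc (suc m)) - y)                    ≈⟨ *-congʳ (P-suc m v y) ⟩
    ((v + 1# - y) * P R m (v + 1#) y) * (v + ι R (suc (suc m)) - y)  ≈⟨ *-assoc _ _ _ ⟩
    (v + 1# - y) * (P R m (v + 1#) y * (v + ι R (suc (suc m)) - y))  ≈⟨ *-congˡ (*-congˡ (+-congʳ (+-assoc v 1# _))) ⟨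
    (v + 1# - y) * P R (suc m) (v + 1#) y                            ∎

  P-cong-diff : ∀ m {v y v′ y′} → v - y ≈ v′ - y′ → P R m v y ≈ P R m v′ y′
  P-cong-diff zero    _   = refl
  P-cong-diff (suc m) {v} {y} {v′} {y′} eq = *-cong (P-cong-diff m eq) (begin
    v + ι R (suc m) - y     ≈⟨ x+y-z≈x-z+y v _ y ⟩
    v - y + ι R (suc m)     ≈⟨ +-congʳ eq ⟩
    v′ - y′ + ι R (suc m)   ≈⟨ x+y-z≈x-z+y v′ _ y′ ⟨
    v′ + ι R (suc m) - y′   ∎)

  P-grid : ℕ → Carrier → Carrier → ℕ → Carrier
  P-grid m v x r = P R m v (ι R (suc r) * x)

  v-ι[1+r]x≈v-x-ι[r]x : ∀ v x r → v - ι R (suc r) * x ≈ v - x - ι R r * x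
  v-ι[1+r]x≈v-x-ι[r]x v x r = trans (+-congˡ (-‿cong (ι-suc-* r x))) (x-[y+z]≈x-y-z v x _)

  P-grid-suc : ∀ m v x r →
    P-grid (suc m) v x r ≈ (v + 1# - x) * P-grid m (v + 1#) x r + (- x) * (ι R r * P-grid m (v + 1#) x r)
  P-grid-suc m v x r = begin
    P-grid (suc m) v x r                    ≈⟨ P-suc m v _ ⟩
    (v + 1# - ι R (suc r) * x) * h          ≈⟨ *-congʳ (v-ι[1+r]x≈v-x-ι[r]x (v + 1#) x r) ⟩
    (w - ι R r * x) * h                     ≈⟨ [y-z]x≈yx-zx h w _ ⟩
    w * h - (ι R r * x) * h                 ≈⟨ +-congˡ (-‿cong (trans (*-congʳ (*-comm _ x)) (*-assoc x _ _))) ⟩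
    w * h - x * (ι R r * h)                 ≈⟨ +-congˡ (-‿distribˡ-* x _) ⟩
    w * h + (- x) * (ι R r * h)             ∎
    where
    w h : Carrier
    w = v + 1# - x
    h = P-grid m (v + 1#) x r

  P-grid-shift : ∀ m v x r → P-grid m v x (suc r) ≈ P-grid m (v - x) x r
  P-grid-shift m v x r = P-cong-diff m (v-ι[1+r]x≈v-x-ι[r]x v x (suc r))

  Δ-P-grid-suc : ∀ m k v x →
    Δ k (P-grid (suc m) v x) ≈
    (v + 1# - x) * Δ k (P-grid m (v + 1#) x) + (- x) * Δ k (λ r → ι R r * P-grid m (v + 1#) x r)
  Δ-P-grid-suc m k v x = begin
    Δ k (P-grid (suc m) v x)                                 ≈⟨ Δ-cong k (P-grid-suc m v x) ⟩
    Δ k (λ r → w * h r + (- x) * (ι R r * h r))              ≈⟨ Δ-+ k _ _ ⟩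
    Δ k (λ r → w * h r) + Δ k (λ r → (- x) * (ι R r * h r))  ≈⟨ +-cong (Δ-*ˡ k w h) (Δ-*ˡ k (- x) _) ⟩
    w * Δ k h + (- x) * Δ k (λ r → ι R r * h r)              ∎
    where
    w : Carrier
    w = v + 1# - x
    h : ℕ → Carrier
    h = P-grid m (v + 1#) x

  Δ-P-grid-nonneg : ∀ {x} → 0# ≤ x → x ≤ 1# → ∀ m k {v} → 0# ≤ v → 0# ≤ Δ k (P-grid m v x)
  Δ-P-grid-nonneg 0≤x x≤1 zero    k 0≤v = Δ-const-nonneg k 0≤1
  Δ-P-grid-nonneg {x} 0≤x x≤1 (suc m) k {v} 0≤v = ≤-respʳ-≈ (sym (Δ-P-grid-suc m k v x)) (nonneg k)
    where
    IH : ∀ k {v} → 0# ≤ v → 0# ≤ Δ k (P-grid m v x)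
    IH = Δ-P-grid-nonneg 0≤x x≤1 m
    w : Carrier
    w = v + 1# - x
    0≤w : 0# ≤ w
    0≤w = ≤-respʳ-≈ (sym (+-assoc v 1# (- x))) (+-nonneg 0≤v (x≤y⇒0≤y-x x≤1))
    0≤v+1 : 0# ≤ (v + 1#)
    0≤v+1 = +-nonneg 0≤v 0≤1
    h : ℕ → Carrier
    h = P-grid m (v + 1#) x
    nonneg : ∀ k → 0# ≤ (w * Δ k h + (- x) * Δ k (λ r → ι R r * h r))
    nonneg zero    = ≤-respʳ-≈ (sym (trans (+-congˡ (trans (*-congˡ (zeroˡ _)) (zeroʳ _))) (+-identityʳ _)))
                               (*-nonneg 0≤w (IH 0 0≤v+1))
    nonneg (suc j) = ≤-respʳ-≈ (+-congˡ (sym (trans (*-congˡ (Δ-ι* j h)) (-x*-y≈x*y x _))))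
      (+-nonneg (*-nonneg 0≤w (IH (suc j) 0≤v+1))
                (*-nonneg 0≤x (*-nonneg (ι-nonneg (suc j))
                  (≤-respʳ-≈ (sym (Δ-cong j (P-grid-shift m (v + 1#) x))) (IH j 0≤w)))))

lemma4 : ∀ {c ℓ₁ ℓ₂} (R : OrderedCommRing c ℓ₁ ℓ₂) (m : ℕ) (k : ℤ)
           (v x : OrderedCommRing.Carrier R) →
           OrderedCommRing._≤_ R (OrderedCommRing.0# R) v →
           OrderedCommRing._≤_ R (OrderedCommRing.0# R) x →
           OrderedCommRing._≤_ R x (OrderedCommRing.1# R) →
           OrderedCommRing._≤_ R (OrderedCommRing.0# R) (Δ̃ R m k v x)
lemma4 R m (+ k)    v x 0≤v 0≤x x≤1 =
  ≤-respʳ-≈ (sym (alternatingBinomialSum≈Δ R k _)) (Δ-P-grid-nonneg R 0≤x x≤1 m k 0≤v)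
  where
  open OrderedCommRing R using (sym; isTotalOrder)
  open IsTotalOrder isTotalOrder using (≤-respʳ-≈)
lemma4 R m -[1+ k ] v x _   _   _   = IsTotalOrder.refl (OrderedCommRing.isTotalOrder R)
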